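{- There exist absolute constants $\varepsilon_0>0$ and $c>0$ such that the following holds. Let $0<\varepsilon<\varepsilon_0$ and $\lambda\ge0$. If $\mathbb{E}_{M\sim\mu_{E;\lambda,G}}[|M|]\ge(1-\varepsilon)\nu(G)$ for every graph $G=(V,E)$, then $\lambda\ge 2^{c/\varepsilon}$ (i.e., $\lambda=2^{\Omega(1/\varepsilon)}$).
   Context: For a graph $G=(V,E)$ and $\lambda\ge 0$, $\mu_{E;\lambda,G}$ is the Gibbs distribution on matchings of $G$: $\mu_{E;\lambda,G}(M)=\lambda^{|M|}/Z$ for each matching $M\subseteq E$, with $Z=\sum_{M'}\lambda^{|M'|}$ over all matchings $M'$ of $G$ (with $0^0=1$). $\nu(G)$ denotes the maximum matching size of $G$.
   Formalization: The parameters ε and λ range only over the rationals, and the absolute constants ε₀ and c are taken in the rationals. -}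

module Defs where

open import Data.Bool using (Bool; true; false; _∧_; not; if_then_else_)
open import Data.Nat as ℕ using (ℕ; zero; suc; _<ᵇ_; _≡ᵇ_)
open import Data.Fin using (Fin; toℕ)
open import Data.List using (List; []; _∷_; _++_; length; map; concatMap; allFin)
open import Data.Product using (_×_; _,_)
open import Data.Rational using (ℚ; 0ℚ; 1ℚ; _+_; _*_; _≤_; _<_)

-- A finite simple graph on vertex set Fin n, given by an adjacency function.
-- Its edge set consists of the pairs (i , j) with i < j and adj i j = true
-- (only the upper triangle is read, so every such function is a simple graph
-- and every simple graph on Fin n arises this way).
Graph : ℕ → Set
Graph n = Fin n → Fin n → Bool

Edge : ℕ → Set
Edge n = Fin n × Fin n

edges : ∀ {n} → Graph n → List (Edge n)
edges {n} G =
  concatMap (λ i → concatMap (λ j →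
      if (toℕ i <ᵇ toℕ j) ∧ G i j then (i , j) ∷ [] else [])
    (allFin n)) (allFin n)

sublists : ∀ {A : Set} → List A → List (List A)
sublists [] = [] ∷ []
sublists (x ∷ xs) = let r = sublists xs in r ++ map (x ∷_) r

_≟ᶠ_ : ∀ {n} → Fin n → Fin n → Bool
i ≟ᶠ j = toℕ i ≡ᵇ toℕ j

share : ∀ {n} → Edge n → Edge n → Bool
share (a , b) (c , d) = not (not (a ≟ᶠ c) ∧ not (a ≟ᶠ d) ∧ not (b ≟ᶠ c) ∧ not (b ≟ᶠ d))

allᵇ : ∀ {A : Set} → (A → Bool) → List A → Bool
allᵇ p [] = true
allᵇ p (x ∷ xs) = p x ∧ allᵇ p xs

isMatching : ∀ {n} → List (Edge n) → Bool
isMatching [] = true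
isMatching (e ∷ es) = allᵇ (λ f → not (share e f)) es ∧ isMatching es

filterᵇ : ∀ {A : Set} → (A → Bool) → List A → List A
filterᵇ p [] = []
filterᵇ p (x ∷ xs) = if p x then x ∷ filterᵇ p xs else filterᵇ p xs

-- all matchings M ⊆ E(G), each listed exactly once
matchings : ∀ {n} → Graph n → List (List (Edge n))
matchings G = filterᵇ isMatching (sublists (edges G))

ν : ∀ {n} → Graph n → ℕ
ν G = Data.List.foldr ℕ._⊔_ 0 (map length (matchings G))

sumℚ : List ℚ → ℚ
sumℚ [] = 0ℚ
sumℚ (x ∷ xs) = x + sumℚ xs

-- natural-number powers in ℚ, with 0 ^ 0 = 1
_^ℚ_ : ℚ → ℕ → ℚ
x ^ℚ zero = 1ℚ
x ^ℚ suc k = x * (x ^ℚ k)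

fromℕ : ℕ → ℚ
fromℕ k = Data.Rational._/_ (Data.Integer.+_ k) 1
  where import Data.Integer

Z : ∀ {n} → ℚ → Graph n → ℚ
Z l G = sumℚ (map (λ M → l ^ℚ length M) (matchings G))

-- Σ_M |M| λ^|M|, so that E_{M∼μ}[|M|] = sizeSum l G / Z l G  (Z ≥ 1)
sizeSum : ∀ {n} → ℚ → Graph n → ℚ
sizeSum l G = sumℚ (map (λ M → fromℕ (length M) * (l ^ℚ length M)) (matchings G))

-- "λ ≥ 2^r" for λ ≥ 0 and real r = c/ε (c, ε > 0 rational):
-- for every rational p/q (q > 0) with p/q ≤ c/ε, i.e. p·ε ≤ c·q, we have λ^q ≥ 2^p.
-- By continuity of x ↦ 2^x this is equivalent to λ ≥ 2^(c/ε).
AtLeastTwoPow : (c ε l : ℚ) → Set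
AtLeastTwoPow c ε l = (p q : ℕ) → 0 ℕ.< q → fromℕ p * ε ≤ c * fromℕ q →
  fromℕ 2 ^ℚ p ≤ l ^ℚ q

module Submission where

-- The test graph is the path 0 – 1 – ⋯ – 4m+1 with the chords 4t+1 – 4t+4 (t < m): a pendant edge
-- followed by a chain of m squares. Its only perfect matching has size k = 2m+1, and it has at least
-- 2^m matchings of size k-1, since each square can be covered by either of its two perfect matchings.
-- With a = (1-ε)k the hypothesis says Σ_M (a - |M|) λ^|M| ≤ 0. There the perfect matching contributes
-- -kε λ^k, the matchings of size k-1 at least 2^m (1-kε) λ^(k-1), the empty matching a > 0, and all
-- other terms are non-negative; when kε ≤ ½ this is impossible unless λ ≥ 2^m. For p/q ≤ c/ε,
-- taking m = ⌊p/q⌋ + 1 keeps kε ≤ ½ (c = 1/8, ε < 1/12) and gives λ^q ≥ 2^(mq) ≥ 2^p.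

open import Defs
open import Data.Bool using (Bool; true; false; _∧_; _∨_; not; if_then_else_; T)
open import Data.Bool.Properties using (if-float)
open import Data.Fin using (Fin; toℕ) renaming (zero to fzero; suc to fsuc)
open import Data.List using (List; []; _∷_; _++_; length; map; foldr; concat; concatMap; allFin)
open import Data.List.Properties
  using (map-++; map-∘; map-cong; map-id; length-map; ++-identityʳ; map-tabulate; map-concatMap; concatMap-cong)
open import Data.List.Relation.Unary.All as All using (All; []; _∷_)
open import Data.List.Relation.Unary.All.Properties using (++⁺; map⁺)
open import Data.Product using (Σ; _×_; _,_; proj₁; proj₂)
open import Function using (_∘_)
open import Relation.Binary.PropositionalEquality
open import Relation.Nullary using (contradiction; yes; no)

module MatchingCounts where

  open import Data.Nat as ℕ using (ℕ; zero; suc; _+_; _*_; _^_; _≤_; _<_; _≡ᵇ_; _⊔_; s≤s; z≤n)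
  open import Data.Nat.Properties as ℕ using (≤-trans; ≤-refl; n≤1+n; m≤m+n; +-assoc)

  module _ {A : Set} where

    filterᵇ-++ : (p : A → Bool) (xs ys : List A) → filterᵇ p (xs ++ ys) ≡ filterᵇ p xs ++ filterᵇ p ys
    filterᵇ-++ p []       ys = refl
    filterᵇ-++ p (x ∷ xs) ys with p x
    ... | true  = cong (x ∷_) (filterᵇ-++ p xs ys)
    ... | false = filterᵇ-++ p xs ys

    filterᵇ-cong : {p q : A → Bool} → (∀ x → p x ≡ q x) → (xs : List A) → filterᵇ p xs ≡ filterᵇ q xs
    filterᵇ-cong p≗q []       = refl
    filterᵇ-cong {p} {q} p≗q (x ∷ xs) rewrite p≗q x with q x
    ... | true  = cong (x ∷_) (filterᵇ-cong p≗q xs)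
    ... | false = filterᵇ-cong p≗q xs

    filterᵇ-accept : {p : A → Bool} → (∀ x → p x ≡ true) → (xs : List A) → filterᵇ p xs ≡ xs
    filterᵇ-accept p≡true []       = refl
    filterᵇ-accept p≡true (x ∷ xs) rewrite p≡true x = cong (x ∷_) (filterᵇ-accept p≡true xs)

    filterᵇ-filterᵇ : (p q : A → Bool) (xs : List A) →
      filterᵇ q (filterᵇ p xs) ≡ filterᵇ (λ x → p x ∧ q x) xs
    filterᵇ-filterᵇ p q []       = refl
    filterᵇ-filterᵇ p q (x ∷ xs) with p x
    ... | false = filterᵇ-filterᵇ p q xs
    ... | true with q x
    ...   | true  = cong (x ∷_) (filterᵇ-filterᵇ p q xs)
    ...   | false = filterᵇ-filterᵇ p q xs

    allᵇ-cong : {p q : A → Bool} → (∀ x → p x ≡ q x) → (xs : List A) → allᵇ p xs ≡ allᵇ q xs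
    allᵇ-cong p≗q []       = refl
    allᵇ-cong p≗q (x ∷ xs) = cong₂ _∧_ (p≗q x) (allᵇ-cong p≗q xs)

  module _ {A B : Set} where

    filterᵇ-map : (p : B → Bool) (g : A → B) (xs : List A) →
      filterᵇ p (map g xs) ≡ map g (filterᵇ (p ∘ g) xs)
    filterᵇ-map p g []       = refl
    filterᵇ-map p g (x ∷ xs) with p (g x)
    ... | true  = cong (g x ∷_) (filterᵇ-map p g xs)
    ... | false = filterᵇ-map p g xs

    filterᵇ-map-accept : {p : B → Bool} {g : A → B} → (∀ x → p (g x) ≡ true) → (xs : List A) →
      filterᵇ p (map g xs) ≡ map g xs
    filterᵇ-map-accept {p} {g} p∘g≡true xs =
      trans (filterᵇ-map p g xs) (cong (map g) (filterᵇ-accept p∘g≡true xs))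

    allᵇ-map : (p : B → Bool) (g : A → B) (xs : List A) → allᵇ p (map g xs) ≡ allᵇ (p ∘ g) xs
    allᵇ-map p g []       = refl
    allᵇ-map p g (x ∷ xs) = cong (p (g x) ∧_) (allᵇ-map p g xs)

    sublists-map : (g : A → B) (xs : List A) → sublists (map g xs) ≡ map (map g) (sublists xs)
    sublists-map g []       = refl
    sublists-map g (x ∷ xs) = begin
        sublists (map g xs) ++ map (g x ∷_) (sublists (map g xs))
      ≡⟨ cong (λ s → s ++ map (g x ∷_) s) (sublists-map g xs) ⟩
        map (map g) (sublists xs) ++ map (g x ∷_) (map (map g) (sublists xs))
      ≡⟨ cong (map (map g) (sublists xs) ++_) (sym (map-∘ (sublists xs))) ⟩
        map (map g) (sublists xs) ++ map (map g ∘ (x ∷_)) (sublists xs)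
      ≡⟨ cong (map (map g) (sublists xs) ++_) (map-∘ (sublists xs)) ⟩
        map (map g) (sublists xs) ++ map (map g) (map (x ∷_) (sublists xs))
      ≡⟨ sym (map-++ (map g) (sublists xs) _) ⟩
        map (map g) (sublists (x ∷ xs))
      ∎
      where open ≡-Reasoning

  module _ {A : Set} (q : A → Bool) where

    filterᵇ-allᵇ-∷-accepted : ∀ {x} → q x ≡ true → (xss : List (List A)) →
      filterᵇ (allᵇ q) (map (x ∷_) xss) ≡ map (x ∷_) (filterᵇ (allᵇ q) xss)
    filterᵇ-allᵇ-∷-accepted qx []         = refl
    filterᵇ-allᵇ-∷-accepted qx (xs ∷ xss) rewrite qx with allᵇ q xs
    ... | true  = cong (_ ∷_) (filterᵇ-allᵇ-∷-accepted qx xss)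
    ... | false = filterᵇ-allᵇ-∷-accepted qx xss

    filterᵇ-allᵇ-∷-rejected : ∀ {x} → q x ≡ false → (xss : List (List A)) →
      filterᵇ (allᵇ q) (map (x ∷_) xss) ≡ []
    filterᵇ-allᵇ-∷-rejected qx []         = refl
    filterᵇ-allᵇ-∷-rejected qx (xs ∷ xss) rewrite qx = filterᵇ-allᵇ-∷-rejected qx xss

    filterᵇ-allᵇ-sublists : (xs : List A) → filterᵇ (allᵇ q) (sublists xs) ≡ sublists (filterᵇ q xs)
    filterᵇ-allᵇ-sublists []       = refl
    filterᵇ-allᵇ-sublists (x ∷ xs)
      rewrite filterᵇ-++ (allᵇ q) (sublists xs) (map (x ∷_) (sublists xs))
      with q x in qx
    ... | true  rewrite filterᵇ-allᵇ-∷-accepted qx (sublists xs) | filterᵇ-allᵇ-sublists xs = refl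
    ... | false rewrite filterᵇ-allᵇ-∷-rejected qx (sublists xs) | filterᵇ-allᵇ-sublists xs = ++-identityʳ _

  module Independence {A : Set} (conflict : A → A → Bool) where

    compatible : A → A → Bool
    compatible x y = not (conflict x y)

    independent : List A → Bool
    independent []       = true
    independent (x ∷ xs) = allᵇ (compatible x) xs ∧ independent xs

    independentSets : List A → List (List A)
    independentSets xs = filterᵇ independent (sublists xs)

    sizeProfile : List A → List ℕ
    sizeProfile xs = map length (independentSets xs)

    independentSets-∷ : ∀ x xs → independentSets (x ∷ xs)
      ≡ independentSets xs ++ map (x ∷_) (independentSets (filterᵇ (compatible x) xs))
    independentSets-∷ x xs = begin
        filterᵇ independent (sublists xs ++ map (x ∷_) (sublists xs))
      ≡⟨ filterᵇ-++ independent (sublists xs) _ ⟩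
        independentSets xs ++ filterᵇ independent (map (x ∷_) (sublists xs))
      ≡⟨ cong (independentSets xs ++_) (filterᵇ-map independent (x ∷_) (sublists xs)) ⟩
        independentSets xs ++ map (x ∷_) (filterᵇ (λ ys → allᵇ (compatible x) ys ∧ independent ys) (sublists xs))
      ≡⟨ cong (λ s → independentSets xs ++ map (x ∷_) s)
              (sym (filterᵇ-filterᵇ (allᵇ (compatible x)) independent (sublists xs))) ⟩
        independentSets xs ++ map (x ∷_) (filterᵇ independent (filterᵇ (allᵇ (compatible x)) (sublists xs)))
      ≡⟨ cong (λ s → independentSets xs ++ map (x ∷_) (filterᵇ independent s))
              (filterᵇ-allᵇ-sublists (compatible x) xs) ⟩
        independentSets xs ++ map (x ∷_) (independentSets (filterᵇ (compatible x) xs))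
      ∎
      where open ≡-Reasoning

    sizeProfile-∷ : ∀ x xs →
      sizeProfile (x ∷ xs) ≡ sizeProfile xs ++ map suc (sizeProfile (filterᵇ (compatible x) xs))
    sizeProfile-∷ x xs = begin
        map length (independentSets (x ∷ xs))
      ≡⟨ cong (map length) (independentSets-∷ x xs) ⟩
        map length (independentSets xs ++ map (x ∷_) ys)
      ≡⟨ map-++ length (independentSets xs) _ ⟩
        sizeProfile xs ++ map length (map (x ∷_) ys)
      ≡⟨ cong (sizeProfile xs ++_) (sym (map-∘ ys)) ⟩
        sizeProfile xs ++ map (suc ∘ length) ys
      ≡⟨ cong (sizeProfile xs ++_) (map-∘ ys) ⟩
        sizeProfile xs ++ map suc (map length ys)
      ∎
      where
      open ≡-Reasoning
      ys = independentSets (filterᵇ (compatible x) xs)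

  open Independence using (independent; sizeProfile)

  module _ {A B : Set} {conflictA : A → A → Bool} {conflictB : B → B → Bool} (g : A → B)
           (g-preserves : ∀ x y → conflictB (g x) (g y) ≡ conflictA x y) where

    independent-map : ∀ xs → independent conflictB (map g xs) ≡ independent conflictA xs
    independent-map []       = refl
    independent-map (x ∷ xs) = cong₂ _∧_
      (trans (allᵇ-map _ g xs) (allᵇ-cong (λ y → cong not (g-preserves x y)) xs))
      (independent-map xs)

    sizeProfile-map : ∀ xs → sizeProfile conflictB (map g xs) ≡ sizeProfile conflictA xs
    sizeProfile-map xs = begin
        map length (filterᵇ (independent conflictB) (sublists (map g xs)))
      ≡⟨ cong (map length ∘ filterᵇ (independent conflictB)) (sublists-map g xs) ⟩
        map length (filterᵇ (independent conflictB) (map (map g) (sublists xs)))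
      ≡⟨ cong (map length) (filterᵇ-map (independent conflictB) (map g) (sublists xs)) ⟩
        map length (map (map g) (filterᵇ (independent conflictB ∘ map g) (sublists xs)))
      ≡⟨ sym (map-∘ _) ⟩
        map (length ∘ map g) (filterᵇ (independent conflictB ∘ map g) (sublists xs))
      ≡⟨ map-cong (length-map g) _ ⟩
        map length (filterᵇ (independent conflictB ∘ map g) (sublists xs))
      ≡⟨ cong (map length) (filterᵇ-cong independent-map (sublists xs)) ⟩
        sizeProfile conflictA xs
      ∎
      where open ≡-Reasoning

  ≡ᵇ-refl : ∀ n → (n ≡ᵇ n) ≡ true
  ≡ᵇ-refl zero    = refl
  ≡ᵇ-refl (suc n) = ≡ᵇ-refl n

  ≡ᵇ-≢ : ∀ {m n} → m ≢ n → (m ≡ᵇ n) ≡ false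
  ≡ᵇ-≢ {m} {n} m≢n with m ≡ᵇ n in eq
  ... | false = refl
  ... | true  = contradiction (ℕ.≡ᵇ⇒≡ m n (subst T (sym eq) _)) m≢n

  count : ℕ → List ℕ → ℕ
  count k []       = 0
  count k (l ∷ ls) = (if k ≡ᵇ l then 1 else 0) + count k ls

  count-++ : ∀ k xs ys → count k (xs ++ ys) ≡ count k xs + count k ys
  count-++ k []       ys = refl
  count-++ k (l ∷ xs) ys =
    trans (cong (_ +_) (count-++ k xs ys)) (sym (+-assoc (if k ≡ᵇ l then 1 else 0) (count k xs) (count k ys)))

  count-map-suc : ∀ k xs → count (suc k) (map suc xs) ≡ count k xs
  count-map-suc k []       = refl
  count-map-suc k (l ∷ xs) = cong (_ +_) (count-map-suc k xs)

  count-beyond : ∀ {b k xs} → All (_≤ b) xs → b < k → count k xs ≡ 0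
  count-beyond {xs = []}     []           b<k = refl
  count-beyond {xs = l ∷ xs} (l≤b ∷ xs≤b) b<k
    rewrite ≡ᵇ-≢ (ℕ.>⇒≢ (ℕ.≤-<-trans l≤b b<k)) = count-beyond xs≤b b<k

  All-++-map-suc : ∀ {b xs ys} → All (_≤ suc b) xs → All (_≤ b) ys → All (_≤ suc b) (xs ++ map suc ys)
  All-++-map-suc xs≤ ys≤ = ++⁺ xs≤ (map⁺ (All.map s≤s ys≤))

  count-++-map-suc : ∀ k xs ys → count (suc k) (xs ++ map suc ys) ≡ count (suc k) xs + count k ys
  count-++-map-suc k xs ys = trans (count-++ (suc k) xs (map suc ys)) (cong (count (suc k) xs +_) (count-map-suc k ys))

  count-≤-++ : ∀ k xs ys → count k xs ≤ count k (xs ++ ys)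
  count-≤-++ k xs ys = ℕ.≤-trans (m≤m+n _ _) (ℕ.≤-reflexive (sym (count-++ k xs ys)))

  count-top : ∀ {k xs} → All (_≤ k) xs → ∀ ys → count (suc k) (xs ++ map suc ys) ≡ count k ys
  count-top {k} {xs} xs≤k ys = trans (count-++-map-suc k xs ys) (cong (_+ count k ys) (count-beyond xs≤k (ℕ.n<1+n k)))

  foldr-⊔-attained : ∀ {b xs} → All (_≤ b) xs → 1 ≤ count b xs → foldr _⊔_ 0 xs ≡ b
  foldr-⊔-attained {xs = xs} xs≤b b∈xs = ℕ.≤-antisym (upper xs≤b) (lower xs b∈xs)
    where
    upper : ∀ {b xs} → All (_≤ b) xs → foldr _⊔_ 0 xs ≤ b
    upper []           = z≤n
    upper (l≤b ∷ xs≤b) = ℕ.⊔-lub l≤b (upper xs≤b)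
    lower : ∀ {b} xs → 1 ≤ count b xs → b ≤ foldr _⊔_ 0 xs
    lower {b} (l ∷ xs) b∈ with b ≡ᵇ l in eq
    ... | true  = ℕ.≤-trans (ℕ.≤-reflexive (ℕ.≡ᵇ⇒≡ b l (subst T (sym eq) _))) (ℕ.m≤m⊔n l _)
    ... | false = ℕ.≤-trans (lower xs b∈) (ℕ.m≤n⊔m l _)

  module _ {A : Set} (conflict : A → A → Bool) where
    open Independence conflict using (compatible; sizeProfile-∷)

    count-0-sizeProfile : ∀ xs → 1 ≤ count 0 (sizeProfile conflict xs)
    count-0-sizeProfile []       = ≤-refl
    count-0-sizeProfile (x ∷ xs) rewrite sizeProfile-∷ x xs =
      ≤-trans (count-0-sizeProfile xs) (count-≤-++ 0 (sizeProfile conflict xs) _)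

  ℕEdge : Set
  ℕEdge = ℕ × ℕ

  -- Written so that meets (label e) (label f) is share e f by definition.
  meets : ℕEdge → ℕEdge → Bool
  meets (a , b) (c , d) = not (not (a ≡ᵇ c) ∧ not (a ≡ᵇ d) ∧ not (b ≡ᵇ c) ∧ not (b ≡ᵇ d))

  open Independence meets using (compatible)

  matchingSizes : List ℕEdge → List ℕ
  matchingSizes = sizeProfile meets

  label : ∀ {n} → Edge n → ℕEdge
  label (i , j) = (toℕ i , toℕ j)

  shift : ℕ → ℕEdge → ℕEdge
  shift v (a , b) = (v + a , v + b)

  +-≡ᵇ : ∀ v a b → (v + a ≡ᵇ v + b) ≡ (a ≡ᵇ b)
  +-≡ᵇ zero    a b = refl
  +-≡ᵇ (suc v) a b = +-≡ᵇ v a b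

  meets-shift : ∀ v e f → meets (shift v e) (shift v f) ≡ meets e f
  meets-shift v (a , b) (c , d) rewrite +-≡ᵇ v a c | +-≡ᵇ v a d | +-≡ᵇ v b c | +-≡ᵇ v b d = refl

  matchingSizes-shift : ∀ v xs → matchingSizes (map (shift v) xs) ≡ matchingSizes xs
  matchingSizes-shift v = sizeProfile-map (shift v) (meets-shift v)

  isMatching-independent : ∀ {n} (es : List (Edge n)) → isMatching es ≡ independent share es
  isMatching-independent []       = refl
  isMatching-independent (e ∷ es) = cong (allᵇ (λ f → not (share e f)) es ∧_) (isMatching-independent es)

  matchings-sizes : ∀ {n} (G : Graph n) → map length (matchings G) ≡ matchingSizes (map label (edges G))
  matchings-sizes G = begin
      map length (filterᵇ isMatching (sublists (edges G)))
    ≡⟨ cong (map length) (filterᵇ-cong isMatching-independent (sublists (edges G))) ⟩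
      sizeProfile share (edges G)
    ≡⟨ sym (sizeProfile-map label (λ _ _ → refl) (edges G)) ⟩
      matchingSizes (map label (edges G))
    ∎
    where open ≡-Reasoning

  induced : (ℕ → ℕ → Bool) → (n : ℕ) → Graph n
  induced a n i j = a (toℕ i) (toℕ j)

  deleteFirst : (ℕ → ℕ → Bool) → ℕ → ℕ → Bool
  deleteFirst a i j = a (suc i) (suc j)

  sucEdge : ∀ {n} → Edge n → Edge (suc n)
  sucEdge (i , j) = (fsuc i , fsuc j)

  concatMap-allFin-suc : ∀ {B : Set} {n} (f : Fin (suc n) → List B) →
    concatMap f (allFin (suc n)) ≡ f fzero ++ concatMap (f ∘ fsuc) (allFin n)
  concatMap-allFin-suc {n = n} f = cong (f fzero ++_) (cong concat
    (trans (map-tabulate fsuc f) (sym (map-tabulate (λ i → i) (f ∘ fsuc)))))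

  edges-induced-suc : ∀ a n → edges (induced a (suc n)) ≡
    concatMap (λ j → if a 0 (suc (toℕ j)) then (fzero , fsuc j) ∷ [] else []) (allFin n)
      ++ map sucEdge (edges (induced (deleteFirst a) n))
  edges-induced-suc a n = begin
      concatMap (row a) (allFin (suc n))
    ≡⟨ concatMap-allFin-suc (row a) ⟩
      row a fzero ++ concatMap (row a ∘ fsuc) (allFin n)
    ≡⟨ cong₂ _++_ (concatMap-allFin-suc (cell a fzero))
                  (concatMap-cong (λ i → concatMap-allFin-suc (cell a (fsuc i))) (allFin n)) ⟩
      row₀ ++ concatMap (λ i → concatMap (cell a (fsuc i) ∘ fsuc) (allFin n)) (allFin n)
    ≡⟨ cong (row₀ ++_) (concatMap-cong shifted-row (allFin n)) ⟩
      row₀ ++ concatMap (map sucEdge ∘ row (deleteFirst a)) (allFin n)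
    ≡⟨ cong (row₀ ++_) (sym (map-concatMap sucEdge (row (deleteFirst a)) (allFin n))) ⟩
      row₀ ++ map sucEdge (edges (induced (deleteFirst a) n))
    ∎
    where
    open ≡-Reasoning
    cell : ∀ {m} → (ℕ → ℕ → Bool) → Fin m → Fin m → List (Edge m)
    cell b i j = if (toℕ i ℕ.<ᵇ toℕ j) ∧ b (toℕ i) (toℕ j) then (i , j) ∷ [] else []
    row : ∀ {m} → (ℕ → ℕ → Bool) → Fin m → List (Edge m)
    row b i = concatMap (cell b i) (allFin _)
    shifted-row : ∀ i → concatMap (cell a (fsuc i) ∘ fsuc) (allFin n) ≡ map sucEdge (row (deleteFirst a) i)
    shifted-row i = trans
      (concatMap-cong (λ j → sym (if-float (map sucEdge) ((toℕ i ℕ.<ᵇ toℕ j) ∧ deleteFirst a (toℕ i) (toℕ j))))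
                      (allFin n))
      (sym (map-concatMap sucEdge _ (allFin n)))
    row₀ = concatMap (cell a fzero ∘ fsuc) (allFin n)

  edgeFrom0 : (ℕ → ℕ → Bool) → ℕ → List ℕEdge
  edgeFrom0 a j = if a 0 (suc j) then (0 , suc j) ∷ [] else []

  neighboursOf0 : (ℕ → ℕ → Bool) → ℕ → List ℕEdge
  neighboursOf0 a n = concatMap (edgeFrom0 a ∘ toℕ) (allFin n)

  edgesℕ : (ℕ → ℕ → Bool) → ℕ → List ℕEdge
  edgesℕ a zero    = []
  edgesℕ a (suc n) = neighboursOf0 a n ++ map (shift 1) (edgesℕ (deleteFirst a) n)

  label-edges-induced : ∀ a n → map label (edges (induced a n)) ≡ edgesℕ a n
  label-edges-induced a zero    = refl
  label-edges-induced a (suc n) = begin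
      map label (edges (induced a (suc n)))
    ≡⟨ cong (map label) (edges-induced-suc a n) ⟩
      map label (row ++ map sucEdge rest)
    ≡⟨ map-++ label row _ ⟩
      map label row ++ map label (map sucEdge rest)
    ≡⟨ cong₂ _++_ (trans (map-concatMap label _ (allFin n))
                         (concatMap-cong (λ j → if-float (map label) (a 0 (suc (toℕ j)))) (allFin n)))
                  (trans (sym (map-∘ rest)) (map-∘ rest)) ⟩
      neighboursOf0 a n ++ map (shift 1) (map label rest)
    ≡⟨ cong (λ es → neighboursOf0 a n ++ map (shift 1) es) (label-edges-induced (deleteFirst a) n) ⟩
      edgesℕ a (suc n)
    ∎
    where
    open ≡-Reasoning
    row = concatMap (λ j → if a 0 (suc (toℕ j)) then (fzero , fsuc j) ∷ [] else []) (allFin n)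
    rest = edges (induced (deleteFirst a) n)

  concatMap-allFin-cutoff : ∀ {B : Set} (g : ℕ → List B) b k → (∀ j → g (b + j) ≡ []) →
    concatMap (g ∘ toℕ) (allFin (b + k)) ≡ concatMap (g ∘ toℕ) (allFin b)
  concatMap-allFin-cutoff g zero zero none = refl
  concatMap-allFin-cutoff g zero (suc k) none = begin
      concatMap (g ∘ toℕ) (allFin (suc k))
    ≡⟨ concatMap-allFin-suc {n = k} (g ∘ toℕ) ⟩
      g 0 ++ concatMap (g ∘ suc ∘ toℕ) (allFin k)
    ≡⟨ cong₂ _++_ (none 0) (concatMap-allFin-cutoff (g ∘ suc) zero k (none ∘ suc)) ⟩
      []
    ∎
    where open ≡-Reasoning
  concatMap-allFin-cutoff g (suc b) k none = begin
      concatMap (g ∘ toℕ) (allFin (suc (b + k)))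
    ≡⟨ concatMap-allFin-suc {n = b + k} (g ∘ toℕ) ⟩
      g 0 ++ concatMap (g ∘ suc ∘ toℕ) (allFin (b + k))
    ≡⟨ cong (g 0 ++_) (concatMap-allFin-cutoff (g ∘ suc) b k none) ⟩
      g 0 ++ concatMap (g ∘ suc ∘ toℕ) (allFin b)
    ≡⟨ sym (concatMap-allFin-suc {n = b} (g ∘ toℕ)) ⟩
      concatMap (g ∘ toℕ) (allFin (suc b))
    ∎
    where open ≡-Reasoning

  map-shift-shift : ∀ v w xs → map (shift v) (map (shift w) xs) ≡ map (shift (v + w)) xs
  map-shift-shift v w xs =
    trans (sym (map-∘ xs)) (map-cong (λ (a , b) → cong₂ _,_ (sym (+-assoc v w a)) (sym (+-assoc v w b))) xs)

  map-shift-edgesℕ-suc : ∀ v a b k → (∀ j → edgeFrom0 a (b + j) ≡ []) →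
    map (shift v) (edgesℕ a (suc (b + k)))
      ≡ map (shift v) (neighboursOf0 a b) ++ map (shift (v + 1)) (edgesℕ (deleteFirst a) (b + k))
  map-shift-edgesℕ-suc v a b k none = begin
      map (shift v) (neighboursOf0 a (b + k) ++ map (shift 1) (edgesℕ (deleteFirst a) (b + k)))
    ≡⟨ map-++ (shift v) (neighboursOf0 a (b + k)) _ ⟩
      map (shift v) (neighboursOf0 a (b + k)) ++ map (shift v) (map (shift 1) (edgesℕ (deleteFirst a) (b + k)))
    ≡⟨ cong₂ _++_ (cong (map (shift v)) (concatMap-allFin-cutoff (edgeFrom0 a) b k none))
                  (map-shift-shift v 1 (edgesℕ (deleteFirst a) (b + k))) ⟩
      map (shift v) (neighboursOf0 a b) ++ map (shift (v + 1)) (edgesℕ (deleteFirst a) (b + k))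
    ∎
    where open ≡-Reasoning

  -- The 4-cycles 4t – 4t+1 – 4t+2 – 4t+3 – 4t, each joined to the next by the edge 4t+3 – 4t+4.
  squaresAdj : ℕ → ℕ → Bool
  squaresAdj 0 j = (j ≡ᵇ 1) ∨ (j ≡ᵇ 3)
  squaresAdj 1 j = j ≡ᵇ 2
  squaresAdj 2 j = j ≡ᵇ 3
  squaresAdj 3 j = j ≡ᵇ 4
  squaresAdj (suc (suc (suc (suc i)))) (suc (suc (suc (suc j)))) = squaresAdj i j
  squaresAdj (suc (suc (suc (suc i)))) _ = false

  squares : ℕ → List ℕEdge
  squares zero    = []
  squares (suc m) = (0 , 1) ∷ (0 , 3) ∷ (1 , 2) ∷ (2 , 3) ∷ (3 , 4) ∷ map (shift 4) (squares m)

  -- Each side condition holds by computation, and deleteFirst applied four times to squaresAdj is squaresAdj.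
  edgesℕ-squares : ∀ m → edgesℕ squaresAdj (suc (m * 4)) ≡ squares m
  edgesℕ-squares zero    = refl
  edgesℕ-squares (suc m) = begin
      edgesℕ squaresAdj (suc (4 + k))
    ≡⟨ sym (map-id _) ⟩
      map (shift 0) (edgesℕ squaresAdj (suc (4 + k)))
    ≡⟨ map-shift-edgesℕ-suc 0 squaresAdj 4 k (λ _ → refl) ⟩
      (0 , 1) ∷ (0 , 3) ∷ map (shift 1) (edgesℕ a₁ (suc (3 + k)))
    ≡⟨ cong (λ es → (0 , 1) ∷ (0 , 3) ∷ es) (map-shift-edgesℕ-suc 1 a₁ 3 k (λ _ → refl)) ⟩
      (0 , 1) ∷ (0 , 3) ∷ (1 , 2) ∷ map (shift 2) (edgesℕ a₂ (suc (2 + k)))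
    ≡⟨ cong (λ es → (0 , 1) ∷ (0 , 3) ∷ (1 , 2) ∷ es) (map-shift-edgesℕ-suc 2 a₂ 2 k (λ _ → refl)) ⟩
      (0 , 1) ∷ (0 , 3) ∷ (1 , 2) ∷ (2 , 3) ∷ map (shift 3) (edgesℕ a₃ (suc (1 + k)))
    ≡⟨ cong (λ es → (0 , 1) ∷ (0 , 3) ∷ (1 , 2) ∷ (2 , 3) ∷ es)
            (map-shift-edgesℕ-suc 3 a₃ 1 k (λ _ → refl)) ⟩
      (0 , 1) ∷ (0 , 3) ∷ (1 , 2) ∷ (2 , 3) ∷ (3 , 4) ∷ map (shift 4) (edgesℕ squaresAdj (suc k))
    ≡⟨ cong (λ es → (0 , 1) ∷ (0 , 3) ∷ (1 , 2) ∷ (2 , 3) ∷ (3 , 4) ∷ map (shift 4) es)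
            (edgesℕ-squares m) ⟩
      squares (suc m)
    ∎
    where
    open ≡-Reasoning
    k = m * 4
    a₁ = deleteFirst squaresAdj
    a₂ = deleteFirst a₁
    a₃ = deleteFirst a₂

  pendantSquaresAdj : ℕ → ℕ → Bool
  pendantSquaresAdj zero    j       = j ≡ᵇ 1
  pendantSquaresAdj (suc i) zero    = false
  pendantSquaresAdj (suc i) (suc j) = squaresAdj i j

  squaresGraph : (m : ℕ) → Graph (2 + m * 4)
  squaresGraph m = induced pendantSquaresAdj (2 + m * 4)

  edgesℕ-pendantSquares : ∀ m → edgesℕ pendantSquaresAdj (2 + m * 4) ≡ (0 , 1) ∷ map (shift 1) (squares m)
  edgesℕ-pendantSquares m = begin
      edgesℕ pendantSquaresAdj (2 + m * 4)
    ≡⟨ sym (map-id _) ⟩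
      map (shift 0) (edgesℕ pendantSquaresAdj (2 + m * 4))
    ≡⟨ map-shift-edgesℕ-suc 0 pendantSquaresAdj 1 (m * 4) (λ _ → refl) ⟩
      (0 , 1) ∷ map (shift 1) (edgesℕ squaresAdj (1 + m * 4))
    ≡⟨ cong (λ es → (0 , 1) ∷ map (shift 1) es) (edgesℕ-squares m) ⟩
      (0 , 1) ∷ map (shift 1) (squares m)
    ∎
    where open ≡-Reasoning

  squares⁻ : ℕ → List ℕEdge
  squares⁻ zero    = []
  squares⁻ (suc m) = (1 , 2) ∷ (2 , 3) ∷ (3 , 4) ∷ map (shift 4) (squares m)

  squares-avoiding-0 : ∀ m → filterᵇ (compatible (0 , 1) ∘ shift 1) (squares m) ≡ squares⁻ m
  squares-avoiding-0 zero    = refl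
  squares-avoiding-0 (suc m) =
    cong (λ es → (1 , 2) ∷ (2 , 3) ∷ (3 , 4) ∷ es) (filterᵇ-map-accept (λ _ → refl) (squares m))

  matchingSizes-∷ : ∀ x xs {ys P Q} → filterᵇ (compatible x) xs ≡ ys →
    matchingSizes xs ≡ P → matchingSizes ys ≡ Q → matchingSizes (x ∷ xs) ≡ P ++ map suc Q
  matchingSizes-∷ x xs refl refl refl = Independence.sizeProfile-∷ meets x xs

  squares-sizes-suc : ∀ m →
    let A  = matchingSizes (map (shift 4) (squares m))
        B  = matchingSizes (map (shift 4) (squares⁻ m))
        P₅ = A ++ map suc B
        P₄ = P₅ ++ map suc A
        P₃ = P₄ ++ map suc P₅
    in matchingSizes (squares⁻ (suc m)) ≡ P₃
     × matchingSizes (squares (suc m)) ≡ (P₃ ++ map suc (A ++ map suc A)) ++ map suc P₄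
  squares-sizes-suc m = p₃ , p₁
    where
    tail = map (shift 4) (squares m)
    A = matchingSizes tail
    B = matchingSizes (map (shift 4) (squares⁻ m))
    P₅ = A ++ map suc B
    P₄ = P₅ ++ map suc A
    P₃ = P₄ ++ map suc P₅
    tail-accepted : ∀ {p} → (∀ e → p (shift 4 e) ≡ true) → filterᵇ p tail ≡ tail
    tail-accepted p∘shift≡true = filterᵇ-map-accept p∘shift≡true (squares m)
    -- compatible (3 , 4) ∘ shift 4 is definitionally compatible (0 , 1) ∘ shift 1: both test avoidance of vertex 0
    tail⁻ : filterᵇ (compatible (3 , 4)) tail ≡ map (shift 4) (squares⁻ m)
    tail⁻ = trans (filterᵇ-map _ (shift 4) (squares m)) (cong (map (shift 4)) (squares-avoiding-0 m))
    X₅ = (3 , 4) ∷ tail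
    X₄ = (2 , 3) ∷ X₅
    X₃ = (1 , 2) ∷ X₄
    X₂ = (0 , 3) ∷ X₃
    p₅ : matchingSizes X₅ ≡ P₅
    p₅ = matchingSizes-∷ (3 , 4) tail tail⁻ refl refl
    p₄ : matchingSizes X₄ ≡ P₄
    p₄ = matchingSizes-∷ (2 , 3) X₅ (tail-accepted λ _ → refl) p₅ refl
    p₃′ : matchingSizes ((1 , 2) ∷ tail) ≡ A ++ map suc A
    p₃′ = matchingSizes-∷ (1 , 2) tail (tail-accepted λ _ → refl) refl refl
    p₃ : matchingSizes X₃ ≡ P₃
    p₃ = matchingSizes-∷ (1 , 2) X₄ (cong ((3 , 4) ∷_) (tail-accepted λ _ → refl)) p₄ p₅
    p₂ : matchingSizes X₂ ≡ P₃ ++ map suc (A ++ map suc A)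
    p₂ = matchingSizes-∷ (0 , 3) X₃ (cong ((1 , 2) ∷_) (tail-accepted λ _ → refl)) p₃ p₃′
    p₁ : matchingSizes (squares (suc m)) ≡ (P₃ ++ map suc (A ++ map suc A)) ++ map suc P₄
    p₁ = matchingSizes-∷ (0 , 1) X₂ (cong (λ es → (2 , 3) ∷ (3 , 4) ∷ es) (tail-accepted λ _ → refl)) p₂ p₄

  square-step-counts : ∀ {d c} {A B : List ℕ} →
    All (_≤ d) A → c ≤ count d A → All (_≤ d) B → count d B ≡ 1 →
    let P₅ = A ++ map suc B
        P₄ = P₅ ++ map suc A
        P₃ = P₄ ++ map suc P₅
        P₁ = (P₃ ++ map suc (A ++ map suc A)) ++ map suc P₄
    in (All (_≤ 2 + d) P₃ × count (2 + d) P₃ ≡ 1) × (All (_≤ 2 + d) P₁ × 2 * c ≤ count (2 + d) P₁)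
  square-step-counts {d} {c} {A} {B} A≤d c≤A B≤d B≡1 = (P₃≤ , P₃≡1) , (P₁≤ , 2c≤P₁)
    where
    P₅ = A ++ map suc B
    P₄ = P₅ ++ map suc A
    P₃ = P₄ ++ map suc P₅
    Y  = A ++ map suc A
    P₂ = P₃ ++ map suc Y
    weaken : ∀ {k xs} → All (_≤ k) xs → All (_≤ suc k) xs
    weaken = All.map ℕ.m≤n⇒m≤1+n
    P₅≤ = All-++-map-suc (weaken A≤d) B≤d
    P₅≡1 = trans (count-top A≤d B) B≡1
    P₄≤ = All-++-map-suc P₅≤ A≤d
    P₄≡ : count (suc d) P₄ ≡ 1 + count d A
    P₄≡ = trans (count-++-map-suc d P₅ A) (cong (_+ count d A) P₅≡1)
    P₃≤ = All-++-map-suc (weaken P₄≤) P₅≤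
    P₃≡1 = trans (count-top P₄≤ P₅) P₅≡1
    P₂≡ : count (2 + d) P₂ ≡ 1 + count d A
    P₂≡ = trans (count-++-map-suc (suc d) P₃ Y) (cong₂ _+_ P₃≡1 (count-top A≤d A))
    P₁≤ = All-++-map-suc (All-++-map-suc P₃≤ (All-++-map-suc (weaken A≤d) A≤d)) P₄≤
    c≤1+A = ≤-trans c≤A (n≤1+n _)
    2c≤P₁ = begin
      2 * c                                         ≡⟨ cong (c +_) (ℕ.+-identityʳ c) ⟩
      c + c                                         ≤⟨ ℕ.+-mono-≤ c≤1+A c≤1+A ⟩
      (1 + count d A) + (1 + count d A)             ≡⟨ sym (cong₂ _+_ P₂≡ P₄≡) ⟩
      count (2 + d) P₂ + count (suc d) P₄           ≡⟨ sym (count-++-map-suc (suc d) P₂ P₄) ⟩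
      count (2 + d) (P₂ ++ map suc P₄)              ∎
      where open ℕ.≤-Reasoning

  squares-counts : ∀ m →
      (All (_≤ m * 2) (matchingSizes (squares m)) × 2 ^ m ≤ count (m * 2) (matchingSizes (squares m)))
    × (All (_≤ m * 2) (matchingSizes (squares⁻ m)) × count (m * 2) (matchingSizes (squares⁻ m)) ≡ 1)
  squares-counts zero    = (z≤n ∷ [] , ≤-refl) , (z≤n ∷ [] , refl)
  squares-counts (suc m)
    with (A≤ , c≤A) , (B≤ , B≡1) ← squares-counts m
    rewrite proj₁ (squares-sizes-suc m) | proj₂ (squares-sizes-suc m)
          | matchingSizes-shift 4 (squares m) | matchingSizes-shift 4 (squares⁻ m)
    with (P₃≤ , P₃≡1) , (P₁≤ , 2c≤P₁) ← square-step-counts A≤ c≤A B≤ B≡1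
    = (P₁≤ , 2c≤P₁) , (P₃≤ , P₃≡1)

  squaresGraph-sizes : ∀ m →
    map length (matchings (squaresGraph m)) ≡ matchingSizes (squares m) ++ map suc (matchingSizes (squares⁻ m))
  squaresGraph-sizes m = begin
      map length (matchings (squaresGraph m))
    ≡⟨ matchings-sizes (squaresGraph m) ⟩
      matchingSizes (map label (edges (squaresGraph m)))
    ≡⟨ cong matchingSizes (trans (label-edges-induced pendantSquaresAdj (2 + m * 4)) (edgesℕ-pendantSquares m)) ⟩
      matchingSizes ((0 , 1) ∷ map (shift 1) (squares m))
    ≡⟨ matchingSizes-∷ (0 , 1) (map (shift 1) (squares m))
         (trans (filterᵇ-map _ (shift 1) (squares m)) (cong (map (shift 1)) (squares-avoiding-0 m)))
         (matchingSizes-shift 1 (squares m)) (matchingSizes-shift 1 (squares⁻ m)) ⟩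
      matchingSizes (squares m) ++ map suc (matchingSizes (squares⁻ m))
    ∎
    where open ≡-Reasoning

  squaresGraph-counts : ∀ m → let P = map length (matchings (squaresGraph m)) in
      All (_≤ suc (m * 2)) P × count (suc (m * 2)) P ≡ 1 × 2 ^ m ≤ count (m * 2) P × 1 ≤ count 0 P
  squaresGraph-counts m
    with (A≤ , 2^m≤A) , (B≤ , B≡1) ← squares-counts m
    rewrite squaresGraph-sizes m =
      All-++-map-suc (All.map ℕ.m≤n⇒m≤1+n A≤) B≤
    , trans (count-top A≤ _) B≡1
    , ≤-trans 2^m≤A (count-≤-++ (m * 2) A _)
    , ≤-trans (count-0-sizeProfile meets (squares m)) (count-≤-++ 0 A _)
    where A = matchingSizes (squares m)

  ν-squaresGraph : ∀ m → ν (squaresGraph m) ≡ suc (m * 2)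
  ν-squaresGraph m with P≤ , top≡1 , _ ← squaresGraph-counts m =
    foldr-⊔-attained P≤ (ℕ.≤-reflexive (sym top≡1))

open MatchingCounts

open import Data.Nat as ℕ using (ℕ; zero; suc; _≡ᵇ_)
import Data.Nat.Properties as ℕ
import Data.Nat.DivMod as ℕ
open import Data.Integer as ℤ using ()
import Data.Integer.Properties as ℤ
open import Data.Rational
  using (ℚ; 0ℚ; 1ℚ; ½; _+_; _-_; _*_; -_; _≤_; _<_; _/_; *≤*; mkℚ; toℚᵘ; nonNegative; NonNegative; Positive)
import Data.Rational.Properties as ℚ
import Data.Rational.Unnormalised as ℚᵘ
import Data.Rational.Unnormalised.Properties as ℚᵘ
open import Data.Rational.Solver using (module +-*-Solver)
import Data.Nat.Coprimality as Coprime

open +-*-Solver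

fromℕ-mkℚ : ∀ k → fromℕ k ≡ mkℚ (ℤ.+ k) 0 (Coprime.sym (Coprime.1-coprimeTo k))
fromℕ-mkℚ k = ℚ.normalize-coprime (Coprime.sym (Coprime.1-coprimeTo k))

toℚᵘ-fromℕ : ∀ k → toℚᵘ (fromℕ k) ≡ ℚᵘ.mkℚᵘ (ℤ.+ k) 0
toℚᵘ-fromℕ k = cong toℚᵘ (fromℕ-mkℚ k)

fromℕ-+ : ∀ a b → fromℕ (a ℕ.+ b) ≡ fromℕ a + fromℕ b
fromℕ-+ a b = ℚ.toℚᵘ-injective (begin
    toℚᵘ (fromℕ (a ℕ.+ b))                    ≡⟨ toℚᵘ-fromℕ (a ℕ.+ b) ⟩
    ℚᵘ.mkℚᵘ (ℤ.+ (a ℕ.+ b)) 0                 ≈⟨ ℚᵘ.*≡* integer-identity ⟩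
    ℚᵘ.mkℚᵘ (ℤ.+ a) 0 ℚᵘ.+ ℚᵘ.mkℚᵘ (ℤ.+ b) 0  ≡⟨ sym (cong₂ ℚᵘ._+_ (toℚᵘ-fromℕ a) (toℚᵘ-fromℕ b)) ⟩
    toℚᵘ (fromℕ a) ℚᵘ.+ toℚᵘ (fromℕ b)        ≈⟨ ℚᵘ.≃-sym (ℚ.toℚᵘ-homo-+ (fromℕ a) (fromℕ b)) ⟩
    toℚᵘ (fromℕ a + fromℕ b)                  ∎)
  where
  open ℚᵘ.≃-Reasoning
  integer-identity : ℤ.+ (a ℕ.+ b) ℤ.* ℤ.+ 1 ≡ (ℤ.+ a ℤ.* ℤ.+ 1 ℤ.+ ℤ.+ b ℤ.* ℤ.+ 1) ℤ.* ℤ.+ 1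
  integer-identity = cong (ℤ._* ℤ.+ 1)
    (trans (ℤ.pos-+ a b) (sym (cong₂ ℤ._+_ (ℤ.*-identityʳ (ℤ.+ a)) (ℤ.*-identityʳ (ℤ.+ b)))))

fromℕ-* : ∀ a b → fromℕ (a ℕ.* b) ≡ fromℕ a * fromℕ b
fromℕ-* a b = ℚ.toℚᵘ-injective (begin
    toℚᵘ (fromℕ (a ℕ.* b))                    ≡⟨ toℚᵘ-fromℕ (a ℕ.* b) ⟩
    ℚᵘ.mkℚᵘ (ℤ.+ (a ℕ.* b)) 0                 ≈⟨ ℚᵘ.*≡* (cong (ℤ._* ℤ.+ 1) (ℤ.pos-* a b)) ⟩
    ℚᵘ.mkℚᵘ (ℤ.+ a) 0 ℚᵘ.* ℚᵘ.mkℚᵘ (ℤ.+ b) 0  ≡⟨ sym (cong₂ ℚᵘ._*_ (toℚᵘ-fromℕ a) (toℚᵘ-fromℕ b)) ⟩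
    toℚᵘ (fromℕ a) ℚᵘ.* toℚᵘ (fromℕ b)        ≈⟨ ℚᵘ.≃-sym (ℚ.toℚᵘ-homo-* (fromℕ a) (fromℕ b)) ⟩
    toℚᵘ (fromℕ a * fromℕ b)                  ∎)
  where open ℚᵘ.≃-Reasoning

fromℕ-nonNeg : ∀ k → 0ℚ ≤ fromℕ k
fromℕ-nonNeg k rewrite fromℕ-mkℚ k = ℚ.nonNegative⁻¹ _

fromℕ-suc-pos : ∀ k → Positive (fromℕ (suc k))
fromℕ-suc-pos k rewrite fromℕ-mkℚ (suc k) = _

fromℕ-mono : ∀ {a b} → a ℕ.≤ b → fromℕ a ≤ fromℕ b
fromℕ-mono {a} {b} a≤b rewrite fromℕ-mkℚ a | fromℕ-mkℚ b =
  *≤* (subst₂ ℤ._≤_ (sym (ℤ.*-identityʳ (ℤ.+ a))) (sym (ℤ.*-identityʳ (ℤ.+ b))) (ℤ.+≤+ a≤b))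

fromℕ-^ : ∀ x n → fromℕ (x ℕ.^ n) ≡ fromℕ x ^ℚ n
fromℕ-^ x zero    = refl
fromℕ-^ x (suc n) = trans (fromℕ-* x (x ℕ.^ n)) (cong (fromℕ x *_) (fromℕ-^ x n))

indicator : ℕ → ℕ → ℚ
indicator c l = if c ≡ᵇ l then 1ℚ else 0ℚ

fromℕ-count : ∀ c P → fromℕ (count c P) ≡ sumℚ (map (indicator c) P)
fromℕ-count c []      = refl
fromℕ-count c (l ∷ P) = trans (fromℕ-+ (if c ≡ᵇ l then 1 else 0) (count c P))
                              (cong₂ _+_ (if-float fromℕ (c ≡ᵇ l)) (fromℕ-count c P))

module _ {A : Set} where

  sumℚ-map-+ : ∀ (f g : A → ℚ) xs → sumℚ (map (λ x → f x + g x) xs) ≡ sumℚ (map f xs) + sumℚ (map g xs)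
  sumℚ-map-+ f g []       = refl
  sumℚ-map-+ f g (x ∷ xs) = trans (cong (λ s → (f x + g x) + s) (sumℚ-map-+ f g xs))
    (solve 4 (λ a b c d → (a :+ b) :+ (c :+ d) := (a :+ c) :+ (b :+ d)) refl (f x) (g x) _ _)

  sumℚ-map-*ʳ : ∀ (f : A → ℚ) c xs → sumℚ (map (λ x → f x * c) xs) ≡ sumℚ (map f xs) * c
  sumℚ-map-*ʳ f c []       = sym (ℚ.*-zeroˡ c)
  sumℚ-map-*ʳ f c (x ∷ xs) =
    trans (cong (λ s → f x * c + s) (sumℚ-map-*ʳ f c xs)) (sym (ℚ.*-distribʳ-+ c (f x) _))

  sumℚ-scale-sub : ∀ c (f g : A → ℚ) xs →
    c * sumℚ (map f xs) - sumℚ (map g xs) ≡ sumℚ (map (λ x → c * f x - g x) xs)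
  sumℚ-scale-sub c f g []       = solve 1 (λ c → c :* con 0ℚ :- con 0ℚ := con 0ℚ) refl c
  sumℚ-scale-sub c f g (x ∷ xs) = trans
    (solve 5 (λ c a as b bs → c :* (a :+ as) :- (b :+ bs) := (c :* a :- b) :+ (c :* as :- bs)) refl c (f x) _ (g x) _)
    (cong (λ s → (c * f x - g x) + s) (sumℚ-scale-sub c f g xs))

  sumℚ-mono : ∀ {P : A → Set} {f g : A → ℚ} {xs} → All P xs → (∀ {x} → P x → f x ≤ g x) →
    sumℚ (map f xs) ≤ sumℚ (map g xs)
  sumℚ-mono []         f≤g = ℚ.≤-refl
  sumℚ-mono (px ∷ pxs) f≤g = ℚ.+-mono-≤ (f≤g px) (sumℚ-mono pxs f≤g)

three-point-bound : ∀ (w : ℕ → ℚ) {i l} → (∀ {h} → h ℕ.< i → 0ℚ ≤ w (suc h)) → l ℕ.≤ 2 ℕ.+ i →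
  indicator (2 ℕ.+ i) l * w (2 ℕ.+ i) + (indicator (suc i) l * w (suc i) + indicator 0 l * w 0) ≤ w l
three-point-bound w {i} {l} w≥0 l≤2+i with l ℕ.≟ 2 ℕ.+ i
... | yes refl rewrite ≡ᵇ-refl i | ≡ᵇ-≢ (ℕ.<⇒≢ (ℕ.n<1+n i)) = ℚ.≤-reflexive
  (solve 3 (λ x y z → con 1ℚ :* x :+ (con 0ℚ :* y :+ con 0ℚ :* z) := x) refl (w (2 ℕ.+ i)) (w (suc i)) (w 0))
... | no l≢2+i with l ℕ.≟ suc i
...   | yes refl rewrite ≡ᵇ-refl i | ≡ᵇ-≢ (ℕ.<⇒≢ (ℕ.n<1+n i) ∘ sym) = ℚ.≤-reflexive
  (solve 3 (λ x y z → con 0ℚ :* x :+ (con 1ℚ :* y :+ con 0ℚ :* z) := y) refl (w (2 ℕ.+ i)) (w (suc i)) (w 0))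
...   | no l≢1+i with l
...     | zero  = ℚ.≤-reflexive
  (solve 3 (λ x y z → con 0ℚ :* x :+ (con 0ℚ :* y :+ con 1ℚ :* z) := z) refl (w (2 ℕ.+ i)) (w (suc i)) (w 0))
...     | suc h rewrite ≡ᵇ-≢ (l≢2+i ∘ sym) | ≡ᵇ-≢ (l≢1+i ∘ sym) = ℚ.≤-trans
  (ℚ.≤-reflexive
    (solve 3 (λ x y z → con 0ℚ :* x :+ (con 0ℚ :* y :+ con 0ℚ :* z) := con 0ℚ) refl (w (2 ℕ.+ i)) (w (suc i)) (w 0)))
  (w≥0 (ℕ.≤-pred (ℕ.≤∧≢⇒< (ℕ.≤-pred (ℕ.≤∧≢⇒< l≤2+i l≢2+i)) l≢1+i)))

nonNeg-* : ∀ {p q} → 0ℚ ≤ p → 0ℚ ≤ q → 0ℚ ≤ p * q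
nonNeg-* {p} {q} 0≤p 0≤q = subst (_≤ p * q) (ℚ.*-zeroˡ q) (ℚ.*-monoʳ-≤-nonNeg q {{nonNegative 0≤q}} 0≤p)

^ℚ-nonNeg : ∀ {x} n → 0ℚ ≤ x → 0ℚ ≤ x ^ℚ n
^ℚ-nonNeg zero    0≤x = ℚ.nonNegative⁻¹ 1ℚ
^ℚ-nonNeg (suc n) 0≤x = nonNeg-* 0≤x (^ℚ-nonNeg n 0≤x)

^ℚ-monoˡ-≤ : ∀ {x y} n → 0ℚ ≤ x → x ≤ y → x ^ℚ n ≤ y ^ℚ n
^ℚ-monoˡ-≤ zero    0≤x x≤y = ℚ.≤-refl
^ℚ-monoˡ-≤ {x} {y} (suc n) 0≤x x≤y = ℚ.≤-trans
  (ℚ.*-monoʳ-≤-nonNeg (x ^ℚ n) {{nonNegative (^ℚ-nonNeg n 0≤x)}} x≤y)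
  (ℚ.*-monoˡ-≤-nonNeg y {{nonNegative (ℚ.≤-trans 0≤x x≤y)}} (^ℚ-monoˡ-≤ n 0≤x x≤y))

p≤q⇒0≤q-p : ∀ {p q} → p ≤ q → 0ℚ ≤ q - p
p≤q⇒0≤q-p {p} {q} p≤q = subst (_≤ q - p) (ℚ.+-inverseʳ p) (ℚ.+-monoˡ-≤ (- p) p≤q)

p≤q⇒p-q≤0 : ∀ {p q} → p ≤ q → p - q ≤ 0ℚ
p≤q⇒p-q≤0 {p} {q} p≤q = subst (p - q ≤_) (ℚ.+-inverseʳ q) (ℚ.+-monoˡ-≤ (- q) p≤q)

p≤p+q : ∀ p {q} → 0ℚ ≤ q → p ≤ p + q
p≤p+q p {q} 0≤q = subst (_≤ p + q) (ℚ.+-identityʳ p) (ℚ.+-monoʳ-≤ p 0≤q)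

-- With b = kε ≤ ½, the c ≥ n ≥ lam matchings of size k-1 outweigh the single one of size k, as 1 - b ≥ b.
deficit-bound : ∀ {a b p lam n c c₀ : ℚ} → 0ℚ ≤ a → 0ℚ ≤ b → b ≤ ½ → 0ℚ ≤ p → 0ℚ ≤ n →
  lam ≤ n → n ≤ c → 1ℚ ≤ c₀ →
  a ≤ 1ℚ * - (b * (lam * p)) + (c * ((1ℚ - b) * p) + c₀ * a)
deficit-bound {a} {b} {p} {lam} {n} {c} {c₀} 0≤a 0≤b b≤½ 0≤p 0≤n lam≤n n≤c 1≤c₀ = begin
  a                                                      ≤⟨ p≤p+q a (nonNeg-* (nonNeg-* 0≤n 0≤p) 0≤1-2b) ⟩
  a + (n * p) * ((1ℚ - b) - b)                           ≡⟨ rearrange ⟩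
  1ℚ * - (b * (n * p)) + (n * ((1ℚ - b) * p) + 1ℚ * a)   ≤⟨ ℚ.+-mono-≤ top (ℚ.+-mono-≤ next empty) ⟩
  1ℚ * - (b * (lam * p)) + (c * ((1ℚ - b) * p) + c₀ * a) ∎
  where
  open ℚ.≤-Reasoning
  0≤1-2b : 0ℚ ≤ (1ℚ - b) - b
  0≤1-2b = subst (0ℚ ≤_) (solve 1 (λ b → (con ½ :- b) :+ (con ½ :- b) := (con 1ℚ :- b) :- b) refl b)
                 (ℚ.+-mono-≤ (p≤q⇒0≤q-p b≤½) (p≤q⇒0≤q-p b≤½))
  0≤1-b : 0ℚ ≤ 1ℚ - b
  0≤1-b = subst (0ℚ ≤_) (solve 1 (λ b → ((con 1ℚ :- b) :- b) :+ b := con 1ℚ :- b) refl b) (ℚ.+-mono-≤ 0≤1-2b 0≤b)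
  rearrange : a + (n * p) * ((1ℚ - b) - b) ≡ 1ℚ * - (b * (n * p)) + (n * ((1ℚ - b) * p) + 1ℚ * a)
  rearrange = solve 4 (λ a b p n → a :+ (n :* p) :* ((con 1ℚ :- b) :- b)
                                   := con 1ℚ :* (:- (b :* (n :* p))) :+ (n :* ((con 1ℚ :- b) :* p) :+ con 1ℚ :* a))
                      refl a b p n
  top : 1ℚ * - (b * (n * p)) ≤ 1ℚ * - (b * (lam * p))
  top = ℚ.*-monoˡ-≤-nonNeg 1ℚ (ℚ.neg-antimono-≤
          (ℚ.*-monoˡ-≤-nonNeg b {{nonNegative 0≤b}} (ℚ.*-monoʳ-≤-nonNeg p {{nonNegative 0≤p}} lam≤n)))
  next : n * ((1ℚ - b) * p) ≤ c * ((1ℚ - b) * p)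
  next = ℚ.*-monoʳ-≤-nonNeg ((1ℚ - b) * p) {{nonNegative (nonNeg-* 0≤1-b 0≤p)}} n≤c
  empty : 1ℚ * a ≤ c₀ * a
  empty = ℚ.*-monoʳ-≤-nonNeg a {{nonNegative 0≤a}} 1≤c₀

sumℚ-indicators : ∀ c₁ c₂ c₃ (x y z : ℚ) P →
  sumℚ (map (λ l → indicator c₁ l * x + (indicator c₂ l * y + indicator c₃ l * z)) P)
    ≡ fromℕ (count c₁ P) * x + (fromℕ (count c₂ P) * y + fromℕ (count c₃ P) * z)
sumℚ-indicators c₁ c₂ c₃ x y z P = begin
    sumℚ (map (λ l → indicator c₁ l * x + (indicator c₂ l * y + indicator c₃ l * z)) P)
  ≡⟨ sumℚ-map-+ (λ l → indicator c₁ l * x) _ P ⟩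
    sumℚ (map (λ l → indicator c₁ l * x) P) + sumℚ (map (λ l → indicator c₂ l * y + indicator c₃ l * z) P)
  ≡⟨ cong (λ s → sumℚ (map (λ l → indicator c₁ l * x) P) + s) (sumℚ-map-+ (λ l → indicator c₂ l * y) _ P) ⟩
    sumℚ (map (λ l → indicator c₁ l * x) P)
      + (sumℚ (map (λ l → indicator c₂ l * y) P) + sumℚ (map (λ l → indicator c₃ l * z) P))
  ≡⟨ cong₂ _+_ (sumℚ-map-*ʳ (indicator c₁) x P)
               (cong₂ _+_ (sumℚ-map-*ʳ (indicator c₂) y P) (sumℚ-map-*ʳ (indicator c₃) z P)) ⟩
    sumℚ (map (indicator c₁) P) * x + (sumℚ (map (indicator c₂) P) * y + sumℚ (map (indicator c₃) P) * z)
  ≡⟨ sym (cong₂ (λ u v → u * x + v) (fromℕ-count c₁ P)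
                (cong₂ (λ u v → u * y + v * z) (fromℕ-count c₂ P) (fromℕ-count c₃ P))) ⟩
    fromℕ (count c₁ P) * x + (fromℕ (count c₂ P) * y + fromℕ (count c₃ P) * z)
  ∎
  where open ≡-Reasoning

activity-bound : ∀ {ε lam : ℚ} {i N : ℕ} {P : List ℕ} → 0ℚ < ε → 0ℚ ≤ lam → fromℕ (2 ℕ.+ i) * ε ≤ ½ →
  All (ℕ._≤ 2 ℕ.+ i) P → count (2 ℕ.+ i) P ≡ 1 → N ℕ.≤ count (suc i) P → 1 ℕ.≤ count 0 P →
  ((1ℚ - ε) * fromℕ (2 ℕ.+ i)) * sumℚ (map (lam ^ℚ_) P) ≤ sumℚ (map (λ l → fromℕ l * lam ^ℚ l) P) →
  fromℕ N ≤ lam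
activity-bound {ε} {lam} {i} {N} {P} 0<ε 0≤lam b≤½ P≤k top≡1 N≤C 1≤C₀ hyp =
  ℚ.≮⇒≥ λ lam<N → ℚ.<-irrefl refl (begin-strict
    0ℚ                                                      <⟨ 0<a ⟩
    a                                                       ≤⟨ deficit-bound (ℚ.<⇒≤ 0<a) 0≤b b≤½ 0≤p
                                                                 (fromℕ-nonNeg N) (ℚ.<⇒≤ lam<N)
                                                                 (fromℕ-mono N≤C) (fromℕ-mono 1≤C₀) ⟩
    1ℚ * - (b * (lam * p)) + (C * ((1ℚ - b) * p) + C₀ * a)  ≡⟨ sym Σφ≡ ⟩
    sumℚ (map φ P)                                          ≤⟨ sumℚ-mono P≤k (three-point-bound w w≥0) ⟩
    sumℚ (map w P)                                          ≡⟨ sym (sumℚ-scale-sub a (lam ^ℚ_) _ P) ⟩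
    a * Zₚ - Sₚ                                             ≤⟨ p≤q⇒p-q≤0 hyp ⟩
    0ℚ                                                      ∎)
  where
  open ℚ.≤-Reasoning
  Zₚ = sumℚ (map (lam ^ℚ_) P)
  Sₚ = sumℚ (map (λ l → fromℕ l * lam ^ℚ l) P)
  k = fromℕ (2 ℕ.+ i)
  j = fromℕ (suc i)
  C = fromℕ (count (suc i) P)
  C₀ = fromℕ (count 0 P)
  a = (1ℚ - ε) * k
  b = k * ε
  p = lam ^ℚ suc i
  w : ℕ → ℚ
  w l = a * lam ^ℚ l - fromℕ l * lam ^ℚ l
  φ : ℕ → ℚ
  φ l = indicator (2 ℕ.+ i) l * w (2 ℕ.+ i) + (indicator (suc i) l * w (suc i) + indicator 0 l * w 0)
  k≡1+j : k ≡ 1ℚ + j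
  k≡1+j = fromℕ-+ 1 (suc i)
  a≡j+1-b : a ≡ j + (1ℚ - b)
  a≡j+1-b = begin-equality
    (1ℚ - ε) * k                  ≡⟨ cong ((1ℚ - ε) *_) k≡1+j ⟩
    (1ℚ - ε) * (1ℚ + j)           ≡⟨ solve 2 (λ j ε → (con 1ℚ :- ε) :* (con 1ℚ :+ j)
                                                      := j :+ (con 1ℚ :- (con 1ℚ :+ j) :* ε)) refl j ε ⟩
    j + (1ℚ - (1ℚ + j) * ε)       ≡⟨ cong (λ k′ → j + (1ℚ - k′ * ε)) (sym k≡1+j) ⟩
    j + (1ℚ - b)                  ∎
  0≤b : 0ℚ ≤ b
  0≤b = nonNeg-* (fromℕ-nonNeg (2 ℕ.+ i)) (ℚ.<⇒≤ 0<ε)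
  ½≤1-b : ½ ≤ 1ℚ - b
  ½≤1-b = ℚ.+-monoʳ-≤ 1ℚ (ℚ.neg-antimono-≤ b≤½)
  j≤a : j ≤ a
  j≤a = subst (j ≤_) (sym a≡j+1-b) (p≤p+q j (ℚ.≤-trans (ℚ.nonNegative⁻¹ ½) ½≤1-b))
  0<a : 0ℚ < a
  0<a = ℚ.<-≤-trans (ℚ.positive⁻¹ ½) (ℚ.≤-trans ½≤1-b
          (subst (1ℚ - b ≤_) (trans (ℚ.+-comm (1ℚ - b) j) (sym a≡j+1-b)) (p≤p+q (1ℚ - b) (fromℕ-nonNeg (suc i)))))
  0≤p : 0ℚ ≤ p
  0≤p = ^ℚ-nonNeg (suc i) 0≤lam
  w≥0 : ∀ {h} → h ℕ.< i → 0ℚ ≤ w (suc h)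
  w≥0 {h} h<i = subst (0ℚ ≤_) (solve 3 (λ a l x → (a :- l) :* x := a :* x :- l :* x) refl a (fromℕ (suc h)) (lam ^ℚ suc h))
    (nonNeg-* (p≤q⇒0≤q-p (ℚ.≤-trans (fromℕ-mono (ℕ.m≤n⇒m≤1+n h<i)) j≤a)) (^ℚ-nonNeg (suc h) 0≤lam))
  Σφ≡ : sumℚ (map φ P) ≡ 1ℚ * - (b * (lam * p)) + (C * ((1ℚ - b) * p) + C₀ * a)
  Σφ≡ = trans (sumℚ-indicators (2 ℕ.+ i) (suc i) 0 (w (2 ℕ.+ i)) (w (suc i)) (w 0) P)
              (cong₂ _+_ (cong₂ _*_ (cong fromℕ top≡1) w-top) (cong₂ (λ x y → C * x + C₀ * y) w-next w-empty))
    where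
    w-top : w (2 ℕ.+ i) ≡ - (b * (lam * p))
    w-top = solve 3 (λ k ε x → (con 1ℚ :- ε) :* k :* x :- k :* x := :- (k :* ε :* x)) refl k ε (lam * p)
    w-next : w (suc i) ≡ (1ℚ - b) * p
    w-next = trans (cong (λ a′ → a′ * p - j * p) a≡j+1-b)
                   (solve 3 (λ j b p → (j :+ (con 1ℚ :- b)) :* p :- j :* p := (con 1ℚ :- b) :* p) refl j b p)
    w-empty : w 0 ≡ a
    w-empty = solve 1 (λ a → a :* con 1ℚ :- con 0ℚ :* con 1ℚ := a) refl a

ε-max : ℚ
ε-max = ℤ.+ 1 / 12

exponent-rate : ℚ
exponent-rate = ℤ.+ 1 / 8

[3+d*2]*ε≤½ : ∀ {ε : ℚ} {p q d : ℕ} → 0ℚ < ε → ε < ε-max → d ℕ.* suc q ℕ.≤ p →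
  fromℕ p * ε ≤ exponent-rate * fromℕ (suc q) → fromℕ (3 ℕ.+ d ℕ.* 2) * ε ≤ ½
[3+d*2]*ε≤½ {ε} {p} {q} {d} 0<ε ε<ε-max dq≤p pε≤cq = ℚ.*-cancelʳ-≤-pos Q {{fromℕ-suc-pos q}} (begin
  (fromℕ (3 ℕ.+ d ℕ.* 2) * ε) * Q                        ≡⟨ cong (λ x → (x * ε) * Q) 3+d*2≡ ⟩
  ((fromℕ 3 + D * fromℕ 2) * ε) * Q                      ≡⟨ rearrange ⟩
  fromℕ 3 * (Q * ε) + fromℕ 2 * ((D * Q) * ε)            ≤⟨ ℚ.+-mono-≤ (scale 3 (scale (suc q) (ℚ.<⇒≤ ε<ε-max)))
                                                                        (scale 2 DQε≤cQ) ⟩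
  fromℕ 3 * (Q * ε-max) + fromℕ 2 * (exponent-rate * Q)  ≡⟨ evaluate ⟩
  ½ * Q                                                  ∎)
  where
  open ℚ.≤-Reasoning
  Q = fromℕ (suc q)
  D = fromℕ d
  nonNeg : ∀ k → NonNegative (fromℕ k)
  nonNeg k = nonNegative (fromℕ-nonNeg k)
  scale : ∀ k {x y} → x ≤ y → fromℕ k * x ≤ fromℕ k * y
  scale k = ℚ.*-monoˡ-≤-nonNeg (fromℕ k) {{nonNeg k}}
  3+d*2≡ : fromℕ (3 ℕ.+ d ℕ.* 2) ≡ fromℕ 3 + D * fromℕ 2
  3+d*2≡ = trans (fromℕ-+ 3 (d ℕ.* 2)) (cong (fromℕ 3 +_) (fromℕ-* d 2))
  rearrange : ((fromℕ 3 + D * fromℕ 2) * ε) * Q ≡ fromℕ 3 * (Q * ε) + fromℕ 2 * ((D * Q) * ε)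
  rearrange = solve 3 (λ D ε Q → ((con (fromℕ 3) :+ D :* con (fromℕ 2)) :* ε) :* Q
                                 := con (fromℕ 3) :* (Q :* ε) :+ con (fromℕ 2) :* ((D :* Q) :* ε)) refl D ε Q
  evaluate : fromℕ 3 * (Q * ε-max) + fromℕ 2 * (exponent-rate * Q) ≡ ½ * Q
  evaluate = solve 1 (λ Q → con (fromℕ 3) :* (Q :* con ε-max) :+ con (fromℕ 2) :* (con exponent-rate :* Q)
                            := con ½ :* Q) refl Q
  DQε≤cQ : (D * Q) * ε ≤ exponent-rate * Q
  DQε≤cQ = ℚ.≤-trans (ℚ.*-monoʳ-≤-nonNeg ε {{nonNegative (ℚ.<⇒≤ 0<ε)}} (subst (_≤ fromℕ p) (fromℕ-* d (suc q))
                                                                                (fromℕ-mono dq≤p))) pε≤cq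

Z-sizes : ∀ {n} lam (G : Graph n) → Z lam G ≡ sumℚ (map (lam ^ℚ_) (map length (matchings G)))
Z-sizes lam G = cong sumℚ (map-∘ (matchings G))

sizeSum-sizes : ∀ {n} lam (G : Graph n) →
  sizeSum lam G ≡ sumℚ (map (λ l → fromℕ l * lam ^ℚ l) (map length (matchings G)))
sizeSum-sizes lam G = cong sumℚ (map-∘ (matchings G))

squaresGraph-forces-activity : ∀ {ε lam} d → 0ℚ < ε → 0ℚ ≤ lam → fromℕ (3 ℕ.+ d ℕ.* 2) * ε ≤ ½ →
  ((1ℚ - ε) * fromℕ (ν (squaresGraph (suc d)))) * Z lam (squaresGraph (suc d)) ≤ sizeSum lam (squaresGraph (suc d)) →
  fromℕ (2 ℕ.^ suc d) ≤ lam
squaresGraph-forces-activity {ε} {lam} d 0<ε 0≤lam b≤½ hyp =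
  let P≤ , top≡1 , 2^m≤C , 1≤C₀ = squaresGraph-counts (suc d)
      G = squaresGraph (suc d)
  in activity-bound 0<ε 0≤lam b≤½ P≤ top≡1 2^m≤C 1≤C₀
       (subst₂ _≤_ (cong₂ (λ k z → ((1ℚ - ε) * fromℕ k) * z) (ν-squaresGraph (suc d)) (Z-sizes lam G))
                   (sizeSum-sizes lam G) hyp)

m≤[1+m/n]*n : ∀ m n .{{_ : ℕ.NonZero n}} → m ℕ.≤ suc (m ℕ./ n) ℕ.* n
m≤[1+m/n]*n m n = begin
  m                         ≡⟨ ℕ.m≡m%n+[m/n]*n m n ⟩
  m ℕ.% n ℕ.+ m ℕ./ n ℕ.* n ≤⟨ ℕ.+-monoˡ-≤ (m ℕ./ n ℕ.* n) (ℕ.<⇒≤ (ℕ.m%n<n m n)) ⟩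
  suc (m ℕ./ n) ℕ.* n       ∎
  where open ℕ.≤-Reasoning

theorem6p1 : Σ ℚ λ ε₀ → Σ ℚ λ c → 0ℚ < ε₀ × 0ℚ < c ×
    ((ε lam : ℚ) → 0ℚ < ε → ε < ε₀ → 0ℚ ≤ lam →
      ((n : ℕ) (G : Graph n) → ((1ℚ - ε) * fromℕ (ν G)) * Z lam G ≤ sizeSum lam G) →
      AtLeastTwoPow c ε lam)
theorem6p1 = ε-max , exponent-rate , ℚ.positive⁻¹ ε-max , ℚ.positive⁻¹ exponent-rate , bound
  where
  bound : (ε lam : ℚ) → 0ℚ < ε → ε < ε-max → 0ℚ ≤ lam →
    ((n : ℕ) (G : Graph n) → ((1ℚ - ε) * fromℕ (ν G)) * Z lam G ≤ sizeSum lam G) →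
    AtLeastTwoPow exponent-rate ε lam
  bound ε lam 0<ε ε<ε-max 0≤lam hyp p (suc q) _ pε≤cq = begin
      fromℕ 2 ^ℚ p                   ≡⟨ sym (fromℕ-^ 2 p) ⟩
      fromℕ (2 ℕ.^ p)                ≤⟨ fromℕ-mono (ℕ.^-monoʳ-≤ 2 p≤mq) ⟩
      fromℕ (2 ℕ.^ (m ℕ.* suc q))    ≡⟨ cong fromℕ (sym (ℕ.^-*-assoc 2 m (suc q))) ⟩
      fromℕ ((2 ℕ.^ m) ℕ.^ suc q)    ≡⟨ fromℕ-^ (2 ℕ.^ m) (suc q) ⟩
      fromℕ (2 ℕ.^ m) ^ℚ suc q       ≤⟨ ^ℚ-monoˡ-≤ (suc q) (fromℕ-nonNeg (2 ℕ.^ m)) 2^m≤lam ⟩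
      lam ^ℚ suc q                   ∎
    where
    open ℚ.≤-Reasoning
    d = p ℕ./ suc q
    m = suc d
    p≤mq : p ℕ.≤ m ℕ.* suc q
    p≤mq = m≤[1+m/n]*n p (suc q)
    2^m≤lam : fromℕ (2 ℕ.^ m) ≤ lam
    2^m≤lam = squaresGraph-forces-activity d 0<ε 0≤lam
      ([3+d*2]*ε≤½ {q = q} {d = d} 0<ε ε<ε-max (ℕ.m/n*n≤m p (suc q)) pε≤cq) (hyp (2 ℕ.+ m ℕ.* 4) (squaresGraph m))
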